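{- Let $G=(V,E)$ be a bipartite undirected unweighted graph on $n$ nodes, let $P\subseteq V\times V$ be a set of node pairs, let $\pi$ be a shortest path tiebreaking scheme that is lazy for $P$, and let $E_H=\pi(P)$. Then the edge set $E_H\setminus\bigcup_{s\in V}\mathcal{B}(T_s)$ can be partitioned into $3n$ induced matchings of $G$.
   Context: A shortest path tiebreaking scheme maps each ordered pair $(s,t)$ to a shortest $s$–$t$ path in $G$; $\pi(Q)$ is the union of the edge sets of $\pi(q)$, $q\in Q$. $P_s=\{(s,t)\in P\}$ and $T_s=(V,\pi(P_s))$. In a tree rooted at $s$ with edges oriented away from $s$, a branching node has out-degree at least 2, branching edges are those leaving branching nodes, and $\mathcal{B}(T)$ is the set of branching edges. $\pi$ is lazy for $P$ if (1) each $T_s$ is a tree rooted at $s$ (possibly plus isolated nodes) and (2) for all $s$ and distinct edges $(x,y),(x',y')\in T_s\setminus\mathcal{B}(T_s)$ with $\mathrm{dist}_G(s,y)=\mathrm{dist}_G(s,y')=\mathrm{dist}_G(s,x)+1=\mathrm{dist}_G(s,x')+1$, $(x,y')\notin E$ and $(x',y)\notin E$. A set of edges $E'$ is an induced matching of $G$ if it is a matching and there is $S\subseteq V$ such that the edges of $G[S]$ are exactly $E'$. -}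

module Defs where

open import Data.Nat using (ℕ; zero; suc; _≤_; _*_)
open import Data.Fin using (Fin)
open import Data.Bool using (Bool; true)
open import Data.List using (List; []; _∷_; length)
open import Data.List.Relation.Unary.Unique.Propositional using (Unique)
open import Data.Product using (Σ; ∃; ∃-syntax; _×_; _,_)
open import Data.Sum using (_⊎_)
open import Data.Empty using (⊥)
open import Relation.Nullary using (¬_)
open import Relation.Binary.PropositionalEquality using (_≡_; _≢_)

Rel : ℕ → Set₁
Rel n = Fin n → Fin n → Set

record Graph (n : ℕ) : Set where
  field
    adj   : Fin n → Fin n → Bool
    sym   : ∀ u v → adj u v ≡ adj v u
    irrefl : ∀ u → adj u u ≢ true
open Graph public

Adj : ∀ {n} → Graph n → Rel n
Adj G u v = adj G u v ≡ true

Bipartite : ∀ {n} → Graph n → Set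
Bipartite {n} G = Σ (Fin n → Bool) λ col → ∀ u v → Adj G u v → col u ≢ col v

-- A walk is a nonempty list of vertices, consecutive ones E-adjacent;
-- its length (number of edges) is (list length - 1).

Chain : ∀ {n} → Rel n → Fin n → List (Fin n) → Fin n → Set
Chain E x []       t = x ≡ t
Chain E x (y ∷ ys) t = E x y × Chain E y ys t

IsWalk : ∀ {n} → Rel n → Fin n → Fin n → List (Fin n) → Set
IsWalk E s t []       = ⊥
IsWalk E s t (x ∷ xs) = x ≡ s × Chain E x xs t

Reachable : ∀ {n} → Rel n → Fin n → Fin n → Set
Reachable E s t = ∃[ p ] IsWalk E s t p

Dist : ∀ {n} → Rel n → Fin n → Fin n → ℕ → Set
Dist E s t d =
  (∃[ p ] (IsWalk E s t p × length p ≡ suc d)) ×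
  (∀ p → IsWalk E s t p → suc d ≤ length p)

IsShortestPath : ∀ {n} → Rel n → Fin n → Fin n → List (Fin n) → Set
IsShortestPath E s t p = IsWalk E s t p × (∀ q → IsWalk E s t q → length p ≤ length q)

Consec : ∀ {n} → List (Fin n) → Rel n
Consec []           u v = ⊥
Consec (x ∷ [])     u v = ⊥
Consec (x ∷ y ∷ ys) u v = (u ≡ x × v ≡ y) ⊎ Consec (y ∷ ys) u v

PathEdge : ∀ {n} → List (Fin n) → Rel n
PathEdge p u v = Consec p u v ⊎ Consec p v u

Scheme : ℕ → Set
Scheme n = Fin n → Fin n → List (Fin n)

IsTiebreaking : ∀ {n} → Graph n → Scheme n → Set
IsTiebreaking G π = ∀ s t → Reachable (Adj G) s t → IsShortestPath (Adj G) s t (π s t)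

PairSet : ℕ → Set
PairSet n = Fin n → Fin n → Bool

πP : ∀ {n} → PairSet n → Scheme n → Rel n
πP P π u v = ∃[ s ] ∃[ t ] (P s t ≡ true × PathEdge (π s t) u v)

Ts : ∀ {n} → PairSet n → Scheme n → Fin n → Rel n
Ts P π s u v = ∃[ t ] (P s t ≡ true × PathEdge (π s t) u v)

HasCycle : ∀ {n} → Rel n → Set
HasCycle {n} E = ∃[ x ] ∃[ xs ] ∃[ y ]
  (Unique (x ∷ xs) × 2 ≤ length xs × IsWalk E x y (x ∷ xs) × E y x)

-- (V , T) is a tree rooted at s plus possibly isolated nodes:
-- every non-isolated node is connected to s in T, and T is acyclic.
IsRootedTree : ∀ {n} → Rel n → Fin n → Set
IsRootedTree T s = (∀ v u → T v u → Reachable T s v) × ¬ HasCycle T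

OutEdge : ∀ {n} → Rel n → Fin n → Fin n → Fin n → Set
OutEdge T s x y = T x y × ∃[ d ] (Dist T s x d × Dist T s y (suc d))

Branching : ∀ {n} → Rel n → Fin n → Fin n → Fin n → Set
Branching T s x y = OutEdge T s x y × ∃[ y' ] (y' ≢ y × OutEdge T s x y')

InB : ∀ {n} → Rel n → Fin n → Fin n → Fin n → Set
InB T s x y = Branching T s x y ⊎ Branching T s y x

IsLazy : ∀ {n} → Graph n → PairSet n → Scheme n → Set
IsLazy {n} G P π = ∀ (s : Fin n) →
  IsRootedTree (Ts P π s) s ×
  (∀ x y x' y' →
     Ts P π s x y → ¬ InB (Ts P π s) s x y →
     Ts P π s x' y' → ¬ InB (Ts P π s) s x' y' →
     ¬ (x ≡ x' × y ≡ y') →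
     (∃[ d ] (Dist (Adj G) s x d × Dist (Adj G) s x' d ×
              Dist (Adj G) s y (suc d) × Dist (Adj G) s y' (suc d))) →
     ¬ Adj G x y' × ¬ Adj G x' y)

IsMatching : ∀ {n} → Rel n → Set
IsMatching M = ∀ u v w → M u v → M u w → v ≡ w

IsInducedMatching : ∀ {n} → Graph n → Rel n → Set
IsInducedMatching {n} G M =
  IsMatching M ×
  Σ (Fin n → Bool) λ S → ∀ u v →
    ((Adj G u v × S u ≡ true × S v ≡ true) → M u v) ×
    (M u v → (Adj G u v × S u ≡ true × S v ≡ true))

NonBranchingEdges : ∀ {n} → PairSet n → Scheme n → Rel n
NonBranchingEdges P π u v = πP P π u v × (∀ s → ¬ InB (Ts P π s) s u v)

PartitionInto : ∀ {n} → Graph n → ℕ → Rel n → Set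
PartitionInto {n} G k R =
  Σ (Fin n → Fin n → Fin k) λ c →
    (∀ u v → R u v → c u v ≡ c v u) ×
    (∀ i → IsInducedMatching G (λ u v → R u v × c u v ≡ i))

module Submission where

-- Colour a non-branching edge {u, v} by a root s with {u, v} ∈ T_s and by the residue mod 3
-- of min(dist(s, u), dist(s, v)).  Within a colour class every edge is oriented away from s
-- and starts at a level ≡ r (mod 3).  Since G is bipartite, every edge of G changes the
-- distance from s by exactly one, so an edge of G between two endpoints of class edges must
-- run from the tail of one class edge to the head of another starting at the same level;
-- laziness forbids this unless the two edges coincide.

open import Defs hiding (sym)
open import Data.Nat as ℕ using (ℕ; zero; suc; _+_; _*_; _∸_; _≤_; _⊓_; s≤s)
open import Data.Nat.Properties
  using (≤-antisym; ≤-pred; ≤-reflexive; n≤1+n; <-asym; +-comm; +-cancelʳ-≤; suc-injective;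
         m≤n⇒m<n∨m≡n; ⊓-comm; m≤n⇒m⊓n≡m)
open import Data.Fin using (Fin; combine; remQuot)
open import Data.Fin.Properties using (_≟_; any?; all?; combine-injective; combine-remQuot)
open import Data.Bool as Bool using (Bool; true; not)
open import Data.Bool.Properties using (¬-not; T-≡)
open import Data.List using (List; []; _∷_; _++_; [_]; length; filter; head; allFin)
open import Data.List.Properties using (length-++; ++-assoc; filter-≐)
open import Data.List.Membership.Propositional using (_∈_)
open import Data.List.Membership.Propositional.Properties using (∈-filter⁺; ∈-filter⁻; ∈-allFin)
open import Data.List.Relation.Unary.Any using (here)
open import Data.Maybe using (fromMaybe)
open import Data.Product using (∃₂; ∃-syntax; _×_; _,_; proj₁; proj₂; map₂)
open import Data.Sum using (_⊎_; inj₁; inj₂)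
open import Data.Empty using (⊥; ⊥-elim)
open import Function using (_∘_; _⇔_; mk⇔; Equivalence)
open import Relation.Nullary using (¬_; Dec; yes; no)
open import Relation.Nullary.Decidable using (isYes; toWitness; fromWitness; ¬?; _×-dec_; _⊎-dec_)
import Relation.Nullary.Decidable as Dec
open import Relation.Binary.PropositionalEquality
  using (_≡_; _≢_; refl; sym; trans; cong; subst; subst₂)

length-snoc : ∀ {A : Set} (xs : List A) y → length (xs ++ [ y ]) ≡ suc (length xs)
length-snoc xs y = trans (length-++ xs) (+-comm (length xs) 1)

chain-map : ∀ {n} {E E′ : Rel n} → (∀ {u v} → E u v → E′ u v) →
            ∀ {x t} ys → Chain E x ys t → Chain E′ x ys t
chain-map f []       c       = c
chain-map f (y ∷ ys) (e , c) = f e , chain-map f ys c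

module _ {n : ℕ} {E : Rel n} where

  chain-++ : ∀ {x m t} ys zs → Chain E x ys m → Chain E m zs t → Chain E x (ys ++ zs) t
  chain-++ []       zs refl    c′ = c′
  chain-++ (y ∷ ys) zs (e , c) c′ = e , chain-++ ys zs c c′

  chain-consec : ∀ {x t} xs → Chain E x xs t →
                 Chain (λ u v → E u v × Consec (x ∷ xs) u v) x xs t
  chain-consec []       c       = c
  chain-consec (y ∷ xs) (e , c) =
    (e , inj₁ (refl , refl)) , chain-map (map₂ inj₂) xs (chain-consec xs c)

  chain-split : ∀ {a t x y} xs → Chain E a xs t → Consec (a ∷ xs) x y →
    ∃₂ λ ys zs → xs ≡ ys ++ y ∷ zs × Chain E a ys x × E x y × Chain E y zs t
  chain-split []       _       ()
  chain-split (b ∷ xs) (e , c) (inj₁ (refl , refl)) = [] , xs , refl , refl , e , c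
  chain-split (b ∷ xs) (e , c) (inj₂ q) with chain-split xs c q
  ... | ys , zs , refl , c₁ , e′ , c₂ = b ∷ ys , zs , refl , (e , c₁) , e′ , c₂

  walk-consec : ∀ {s t u v} p → IsWalk E s t p → Consec p u v → E u v
  walk-consec (x ∷ xs) (refl , c) q with chain-split xs c q
  ... | _ , _ , _ , _ , e , _ = e

  dist-unique : ∀ {s v a b} → Dist E s v a → Dist E s v b → a ≡ b
  dist-unique ((p , w , |p|) , a-min) ((q , w′ , |q|) , b-min) =
    suc-injective (≤-antisym (subst (_ ≤_) |q| (a-min q w′)) (subst (_ ≤_) |p| (b-min p w)))

  shortest-dist : ∀ {s v} p → IsShortestPath E s v p → Dist E s v (length p ∸ 1)
  shortest-dist (x ∷ xs) (w , minimal) = (x ∷ xs , w , refl) , minimal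

  dist-step-≤ : ∀ {s u v a b} → Dist E s u a → Dist E s v b → E u v → b ≤ suc a
  dist-step-≤ {v = v} {b = b} ((x ∷ xs , (refl , c) , refl) , _) (_ , b-min) e =
    ≤-pred (subst (suc b ≤_) (cong suc (length-snoc xs v))
                  (b-min (x ∷ xs ++ [ v ]) (refl , chain-++ xs [ v ] c (e , refl))))

  prefix-dist : ∀ {s t m} ys zs →
    (∀ q → IsWalk E s t q → length (s ∷ ys ++ zs) ≤ length q) →
    Chain E s ys m → Chain E m zs t → Dist E s m (length ys)
  prefix-dist {s} ys zs minimal c₁ c₂ = (s ∷ ys , (refl , c₁) , refl) , prefix-minimal
    where
    prefix-minimal : ∀ q → IsWalk E s _ q → suc (length ys) ≤ length q
    prefix-minimal (q₀ ∷ qs) (refl , c) =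
      s≤s (+-cancelʳ-≤ (length zs) (length ys) (length qs)
            (subst₂ _≤_ (length-++ ys) (length-++ qs)
              (≤-pred (minimal (q₀ ∷ qs ++ zs) (refl , chain-++ qs zs c c₂)))))

dist-restrict : ∀ {n} {E T : Rel n} {s v k} → (∀ {u w} → T u w → E u w) → Dist E s v k →
  ∃[ p ] (IsWalk T s v p × length p ≡ suc k) → Dist T s v k
dist-restrict T⊆E (_ , minimal) walk =
  walk , λ { (q ∷ qs) (refl , c) → minimal (q ∷ qs) (refl , chain-map T⊆E qs c) }

shortest-step-dist : ∀ {n} {E T : Rel n} {s t x y} p → IsShortestPath E s t p →
  (∀ {u w} → T u w → E u w) → (∀ {u w} → Consec p u w → T u w) → Consec p x y →
  ∃[ k ] (Dist E s x k × Dist E s y (suc k) × Dist T s x k × Dist T s y (suc k) × E x y)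
shortest-step-dist {E = E} {T} {s} {x = x} {y} (_ ∷ xs) ((refl , c) , minimal) T⊆E steps q
  with chain-split xs (chain-consec xs c) q
... | ys , zs , refl , c₁ , (e , q′) , c₂ =
  length ys , dist-x , dist-y , dist-restrict T⊆E dist-x (s ∷ ys , (refl , c₁T) , refl) ,
  dist-restrict T⊆E dist-y (s ∷ ys ++ [ y ] , (refl , chain-++ ys [ y ] c₁T (steps q′ , refl)) ,
                            cong suc (length-snoc ys y)) ,
  e
  where
  c₁E = chain-map proj₁ ys c₁
  c₂E = chain-map proj₁ zs c₂
  c₁T = chain-map (steps ∘ proj₂) ys c₁
  dist-x : Dist E s x (length ys)
  dist-x = prefix-dist ys (y ∷ zs) minimal c₁E (e , c₂E)
  dist-y : Dist E s y (suc (length ys))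
  dist-y = subst (Dist E s y) (length-snoc ys y)
    (prefix-dist (ys ++ [ y ]) zs
      (λ r w → subst (λ l → suc (length l) ≤ length r) (sym (++-assoc ys [ y ] zs)) (minimal r w))
      (chain-++ ys [ y ] c₁E (e , refl)) c₂E)

Adj-sym : ∀ {n} (G : Graph n) {u v} → Adj G u v → Adj G v u
Adj-sym G {u} {v} e = trans (Graph.sym G v u) e

flips : ℕ → Bool → Bool
flips zero    b = b
flips (suc k) b = flips k (not b)

module _ {n : ℕ} {G : Graph n} (bipartite : Bipartite G) where

  private
    side   = proj₁ bipartite
    proper = proj₂ bipartite

  chain-colour : ∀ {x t} ys → Chain (Adj G) x ys t → side t ≡ flips (length ys) (side x)
  chain-colour []       refl    = refl
  chain-colour (y ∷ ys) (e , c) =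
    trans (chain-colour ys c) (cong (flips (length ys)) (¬-not (proper _ _ e ∘ sym)))

  dist-colour : ∀ {s v a} → Dist (Adj G) s v a → side v ≡ flips a (side s)
  dist-colour ((x ∷ xs , (refl , c) , refl) , _) = chain-colour xs c

  -- Levels differ by at most one along an edge, and parity rules out equal levels.
  adjacent-dist : ∀ {s u v a b} → Dist (Adj G) s u a → Dist (Adj G) s v b → Adj G u v →
                  b ≡ suc a ⊎ a ≡ suc b
  adjacent-dist {s} {u} {v} du dv e with m≤n⇒m<n∨m≡n (dist-step-≤ du dv e)
  ... | inj₂ b≡1+a = inj₁ b≡1+a
  ... | inj₁ b≤a with m≤n⇒m<n∨m≡n (dist-step-≤ dv du (Adj-sym G e))
  ...   | inj₂ a≡1+b = inj₂ a≡1+b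
  ...   | inj₁ a≤b = ⊥-elim (proper u v e
          (trans (dist-colour du)
            (trans (cong (λ k → flips k (side s)) (≤-antisym (≤-pred a≤b) (≤-pred b≤a)))
                   (sym (dist-colour dv)))))

cycle3 : Fin 3 → Fin 3
cycle3 Fin.zero                     = Fin.suc Fin.zero
cycle3 (Fin.suc Fin.zero)           = Fin.suc (Fin.suc Fin.zero)
cycle3 (Fin.suc (Fin.suc Fin.zero)) = Fin.zero

mod3 : ℕ → Fin 3
mod3 zero    = Fin.zero
mod3 (suc k) = cycle3 (mod3 k)

mod3-suc-≢ : ∀ k → mod3 (suc k) ≢ mod3 k
mod3-suc-≢ k with mod3 k
... | Fin.zero                   = λ ()
... | Fin.suc Fin.zero           = λ ()
... | Fin.suc (Fin.suc Fin.zero) = λ ()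

mod3-2+-≢ : ∀ k → mod3 (2 + k) ≢ mod3 k
mod3-2+-≢ k with mod3 k
... | Fin.zero                   = λ ()
... | Fin.suc Fin.zero           = λ ()
... | Fin.suc (Fin.suc Fin.zero) = λ ()

module _ {n : ℕ} (M : Rel n) (level : Fin n → ℕ) (r : Fin 3) where

  Rising : Rel n
  Rising x y = M x y × level y ≡ suc (level x) × mod3 (level x) ≡ r

  -- Adjacent M-endpoints lie on consecutive levels, so by the residues they are the tail of
  -- one rising edge and the head of another rising from the same level; the last
  -- hypothesis then forces the two edges to coincide.
  levelled⇒inducedMatching : (G : Graph n) →
    (∀ u v → Dec (M u v)) →
    (∀ {u v} → M u v → M v u) →
    (∀ {u v} → M u v → Adj G u v) →
    (∀ {u v} → M u v → Rising u v ⊎ Rising v u) →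
    (∀ {u v w z} → M u w → M v z → Adj G u v → level v ≡ suc (level u) ⊎ level u ≡ suc (level v)) →
    (∀ {x y x′ y′} → Rising x y → Rising x′ y′ → level x ≡ level x′ →
       ¬ (x ≡ x′ × y ≡ y′) → ¬ Adj G x y′) →
    IsInducedMatching G M
  levelled⇒inducedMatching G M? M-sym M-adj rising graded unlinked =
    matching , S , λ u v →
      (λ { (e , su , sv) → induced e (proj₂ (partner su)) (proj₂ (partner sv)) }) ,
      (λ m → M-adj m , endpoint m , endpoint (M-sym m))
    where
    gap₁ : ∀ {a b} → mod3 a ≡ r → mod3 b ≡ r → b ≡ suc a → ⊥
    gap₁ {a} ra rb refl = mod3-suc-≢ a (trans rb (sym ra))

    gap₂ : ∀ {a b} → mod3 a ≡ r → mod3 b ≡ r → b ≡ suc (suc a) → ⊥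
    gap₂ {a} ra rb refl = mod3-2+-≢ a (trans rb (sym ra))

    gap : ∀ {a b} → mod3 a ≡ r → mod3 b ≡ r → b ≡ suc a ⊎ a ≡ suc b → ⊥
    gap ra rb (inj₁ e) = gap₁ ra rb e
    gap ra rb (inj₂ e) = gap₁ rb ra e

    adjacent-pred : ∀ {a b a′ b′} → a′ ≡ suc a → b′ ≡ suc b → b′ ≡ suc a′ ⊎ a′ ≡ suc b′ →
            b ≡ suc a ⊎ a ≡ suc b
    adjacent-pred refl refl (inj₁ e) = inj₁ (suc-injective e)
    adjacent-pred refl refl (inj₂ e) = inj₂ (suc-injective e)

    same-tail : ∀ {u v w} → Rising u v → Rising u w → v ≡ w
    same-tail {v = v} {w} uv uw with v ≟ w
    ... | yes v≡w = v≡w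
    ... | no  v≢w = ⊥-elim (unlinked uv uw refl (v≢w ∘ proj₂) (M-adj (proj₁ uw)))

    same-head : ∀ {u v w} → Rising v u → Rising w u → v ≡ w
    same-head {v = v} {w} vu@(_ , hv , _) wu@(_ , hw , _) with v ≟ w
    ... | yes v≡w = v≡w
    ... | no  v≢w = ⊥-elim (unlinked vu wu (suc-injective (trans (sym hv) hw)) (v≢w ∘ proj₁)
                              (M-adj (proj₁ vu)))

    matching : IsMatching M
    matching u v w muv muw with rising muv | rising muw
    ... | inj₁ uv            | inj₁ uw            = same-tail uv uw
    ... | inj₂ vu            | inj₂ wu            = same-head vu wu
    ... | inj₁ (_ , _ , ru)  | inj₂ (_ , hw , rw) = ⊥-elim (gap₁ rw ru hw)
    ... | inj₂ (_ , hv , rv) | inj₁ (_ , _ , ru)  = ⊥-elim (gap₁ rv ru hv)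

    cross : ∀ {u v w z} → Adj G u v → Rising u w → Rising z v → level v ≡ suc (level u) → M u v
    cross {u} {v} {w} {z} e uw zv@(_ , hv , _) v≡1+u with (u ≟ z) ×-dec (w ≟ v)
    ... | yes (refl , refl) = proj₁ uw
    ... | no  distinct      =
      ⊥-elim (unlinked uw zv (suc-injective (trans (sym v≡1+u) hv)) distinct e)

    induced : ∀ {u v w z} → Adj G u v → M u w → M v z → M u v
    induced e muw mvz with rising muw | rising mvz | graded muw mvz e
    ... | inj₁ (_ , _ , ru)  | inj₁ (_ , _ , rv)  | L      = ⊥-elim (gap ru rv L)
    ... | inj₂ (_ , hu , rw) | inj₂ (_ , hv , rz) | L      = ⊥-elim (gap rw rz (adjacent-pred hu hv L))
    ... | inj₁ uw            | inj₂ zv            | inj₁ L = cross e uw zv L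
    ... | inj₁ (_ , _ , ru)  | inj₂ (_ , hv , rz) | inj₂ L = ⊥-elim (gap₂ rz ru (trans L (cong suc hv)))
    ... | inj₂ (_ , hu , rw) | inj₁ (_ , _ , rv)  | inj₁ L = ⊥-elim (gap₂ rw rv (trans L (cong suc hu)))
    ... | inj₂ wu            | inj₁ vz            | inj₂ L = M-sym (cross (Adj-sym G e) vz wu L)

    S : Fin n → Bool
    S u = isYes (any? (M? u))

    endpoint : ∀ {u v} → M u v → S u ≡ true
    endpoint {u} {v} m = Equivalence.to T-≡ (fromWitness {a? = any? (M? u)} (v , m))

    partner : ∀ {u} → S u ≡ true → ∃[ w ] M u w
    partner {u} s = toWitness {a? = any? (M? u)} (Equivalence.from T-≡ s)

consec? : ∀ {n} (p : List (Fin n)) u v → Dec (Consec p u v)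
consec? []           u v = no λ ()
consec? (x ∷ [])     u v = no λ ()
consec? (x ∷ y ∷ ys) u v = ((u ≟ x) ×-dec (v ≟ y)) ⊎-dec consec? (y ∷ ys) u v

pathEdge? : ∀ {n} (p : List (Fin n)) u v → Dec (PathEdge p u v)
pathEdge? p u v = consec? p u v ⊎-dec consec? p v u

head-∈ : ∀ {A : Set} (d : A) {x : A} {xs} → x ∈ xs → fromMaybe d (head xs) ∈ xs
head-∈ d {xs = _ ∷ _} _ = here refl

head-default-irrelevant : ∀ {A : Set} (d d′ : A) {x : A} {xs} → x ∈ xs →
                          fromMaybe d (head xs) ≡ fromMaybe d′ (head xs)
head-default-irrelevant d d′ {xs = _ ∷ _} _ = refl

suc-asym : ∀ {a b} → a ≡ suc b → b ≡ suc a → ⊥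
suc-asym a≡1+b b≡1+a = <-asym (≤-reflexive (sym b≡1+a)) (≤-reflexive (sym a≡1+b))

module TreeLevels {n : ℕ} (G : Graph n) (P : PairSet n) (π : Scheme n)
  (tiebreaking : IsTiebreaking G π)
  (reachable : ∀ s t → P s t ≡ true → Reachable (Adj G) s t) where

  T : Fin n → Rel n
  T = Ts P π

  -- Junk value 0 if π s v is empty; whenever v is reachable from s it is dist_G(s, v).
  level : Fin n → Fin n → ℕ
  level s v = length (π s v) ∸ 1

  level-dist : ∀ {s v k} → Dist (Adj G) s v k → Dist (Adj G) s v (level s v)
  level-dist {s} {v} ((p , w , _) , _) = shortest-dist (π s v) (tiebreaking s v (p , w))

  T-sym : ∀ {s u v} → T s u v → T s v u
  T-sym (t , pst , inj₁ q) = t , pst , inj₂ q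
  T-sym (t , pst , inj₂ q) = t , pst , inj₁ q

  T-adj : ∀ {s u v} → T s u v → Adj G u v
  T-adj {s} (t , pst , inj₁ q) = walk-consec (π s t) (proj₁ (tiebreaking s t (reachable s t pst))) q
  T-adj {s} (t , pst , inj₂ q) =
    Adj-sym G (walk-consec (π s t) (proj₁ (tiebreaking s t (reachable s t pst))) q)

  record Away (s x y : Fin n) : Set where
    field
      rises      : level s y ≡ suc (level s x)
      dist-x     : Dist (Adj G) s x (level s x)
      dist-y     : Dist (Adj G) s y (level s y)
      treeDist-x : Dist (T s) s x (level s x)
      treeDist-y : Dist (T s) s y (level s y)
  open Away

  path-step-away : ∀ {s t x y} → P s t ≡ true → Consec (π s t) x y → Away s x y
  path-step-away {s} {t} {x} {y} pst q
    with shortest-step-dist (π s t) (tiebreaking s t (reachable s t pst)) T-adj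
                            (λ q′ → t , pst , inj₁ q′) q
  ... | k , dx , dy , tdx , tdy , _ = record
    { rises      = trans y≡1+k (cong suc (sym x≡k))
    ; dist-x     = subst (Dist (Adj G) s x) (sym x≡k) dx
    ; dist-y     = subst (Dist (Adj G) s y) (sym y≡1+k) dy
    ; treeDist-x = subst (Dist (T s) s x) (sym x≡k) tdx
    ; treeDist-y = subst (Dist (T s) s y) (sym y≡1+k) tdy
    }
    where
    x≡k : level s x ≡ k
    x≡k = dist-unique (level-dist dx) dx
    y≡1+k : level s y ≡ suc k
    y≡1+k = dist-unique (level-dist dy) dy

  orient : ∀ {s x y} → T s x y → Away s x y ⊎ Away s y x
  orient (t , pst , inj₁ q) = inj₁ (path-step-away pst q)
  orient (t , pst , inj₂ q) = inj₂ (path-step-away pst q)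

  endpoint-dist : ∀ {s u v} → T s u v → Dist (Adj G) s u (level s u)
  endpoint-dist t with orient t
  ... | inj₁ a = dist-x a
  ... | inj₂ a = dist-y a

  away-⊓ : ∀ {s x y} → Away s x y → level s x ⊓ level s y ≡ level s x
  away-⊓ {s} {x} a = m≤n⇒m⊓n≡m (subst (level s x ≤_) (sym (rises a)) (n≤1+n (level s x)))

  levelUp⇔outEdge : ∀ {s x y} → (T s x y × level s y ≡ suc (level s x)) ⇔ OutEdge (T s) s x y
  levelUp⇔outEdge {s} {x} {y} = mk⇔ to from
    where
    to : T s x y × level s y ≡ suc (level s x) → OutEdge (T s) s x y
    to (txy , up) with orient txy
    ... | inj₁ a = txy , level s x , treeDist-x a , subst (Dist (T s) s y) up (treeDist-y a)
    ... | inj₂ a = ⊥-elim (suc-asym (rises a) up)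
    from : OutEdge (T s) s x y → T s x y × level s y ≡ suc (level s x)
    from (txy , d , dx , dy) with orient txy
    ... | inj₁ a = txy , rises a
    ... | inj₂ a = ⊥-elim (suc-asym (rises a)
                     (trans (dist-unique (treeDist-x a) dy)
                            (cong suc (dist-unique dx (treeDist-y a)))))

  T? : ∀ s u v → Dec (T s u v)
  T? s u v = any? λ t → (P s t Bool.≟ true) ×-dec pathEdge? (π s t) u v

  outEdge? : ∀ s x y → Dec (OutEdge (T s) s x y)
  outEdge? s x y = Dec.map levelUp⇔outEdge (T? s x y ×-dec (level s y ℕ.≟ suc (level s x)))

  branching? : ∀ s x y → Dec (Branching (T s) s x y)
  branching? s x y = outEdge? s x y ×-dec any? (λ y′ → ¬? (y′ ≟ y) ×-dec outEdge? s x y′)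

  inB? : ∀ s x y → Dec (InB (T s) s x y)
  inB? s x y = branching? s x y ⊎-dec branching? s y x

  nonBranching? : ∀ u v → Dec (NonBranchingEdges P π u v)
  nonBranching? u v = any? (λ s → T? s u v) ×-dec all? (λ s → ¬? (inB? s u v))

  nonBranching-sym : ∀ {u v} → NonBranchingEdges P π u v → NonBranchingEdges P π v u
  nonBranching-sym ((s , t) , notB) = (s , T-sym t) , λ s′ → notB s′ ∘ swap
    where
    swap : ∀ {s′ u v} → InB (T s′) s′ u v → InB (T s′) s′ v u
    swap (inj₁ b) = inj₂ b
    swap (inj₂ b) = inj₁ b

  -- Taking the first root in a fixed order makes the choice symmetric in u and v.
  sources : Fin n → Fin n → List (Fin n)
  sources u v = filter (λ s → T? s u v) (allFin n)

  source : Fin n → Fin n → Fin n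
  source u v = fromMaybe u (head (sources u v))

  source-∈ : ∀ {s u v} → T s u v → source u v ∈ sources u v
  source-∈ {s} {u} {v} t = head-∈ u (∈-filter⁺ (λ s → T? s u v) (∈-allFin s) t)

  source-tree : ∀ {s u v} → T s u v → T (source u v) u v
  source-tree {u = u} {v} t = proj₂ (∈-filter⁻ (λ s → T? s u v) {xs = allFin n} (source-∈ t))

  source-sym : ∀ {s u v} → T s u v → source u v ≡ source v u
  source-sym {u = u} {v} t = trans
    (head-default-irrelevant u v (source-∈ t))
    (cong (fromMaybe v ∘ head)
          (filter-≐ (λ s → T? s u v) (λ s → T? s v u) (T-sym , T-sym) (allFin n)))

  band : Fin n → Fin n → ℕ
  band u v = level (source u v) u ⊓ level (source u v) v

  colour : Fin n → Fin n → Fin (3 * n)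
  colour u v = combine (mod3 (band u v)) (source u v)

  colour-sym : ∀ {s u v} → T s u v → colour u v ≡ colour v u
  colour-sym {u = u} {v} t rewrite source-sym t =
    cong (λ b → combine (mod3 b) (source v u)) (⊓-comm (level (source v u) u) (level (source v u) v))

  module _ (bipartite : Bipartite G) (lazy : IsLazy G P π) where

    Class : Fin 3 → Fin n → Rel n
    Class r s u v = NonBranchingEdges P π u v × colour u v ≡ combine r s

    module _ {r : Fin 3} {s : Fin n} where

      class-tree : ∀ {u v} → Class r s u v → T s u v
      class-tree {u} {v} (((_ , t) , _) , c)
        with combine-injective (mod3 (band u v)) (source u v) r s c
      ... | _ , refl = source-tree t

      class-residue : ∀ {u v} → Class r s u v → mod3 (level s u ⊓ level s v) ≡ r
      class-residue {u} {v} (_ , c) with combine-injective (mod3 (band u v)) (source u v) r s c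
      ... | residue , refl = residue

      class-sym : ∀ {u v} → Class r s u v → Class r s v u
      class-sym (e , c) = nonBranching-sym e , trans (sym (colour-sym (proj₂ (proj₁ e)))) c

      class-rising : ∀ {u v} → Class r s u v →
                     Rising (Class r s) (level s) r u v ⊎ Rising (Class r s) (level s) r v u
      class-rising {u} {v} m with orient (class-tree m)
      ... | inj₁ a = inj₁ (m , rises a , trans (cong mod3 (sym (away-⊓ a))) (class-residue m))
      ... | inj₂ a = inj₂ (class-sym m , rises a ,
                           trans (cong mod3 (sym (trans (⊓-comm _ _) (away-⊓ a)))) (class-residue m))

      class-graded : ∀ {u v w z} → Class r s u w → Class r s v z → Adj G u v →
                     level s v ≡ suc (level s u) ⊎ level s u ≡ suc (level s v)
      class-graded muw mvz =
        adjacent-dist {G = G} bipartite (endpoint-dist (class-tree muw)) (endpoint-dist (class-tree mvz))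

      class-unlinked : ∀ {x y x′ y′} →
        Rising (Class r s) (level s) r x y → Rising (Class r s) (level s) r x′ y′ →
        level s x ≡ level s x′ → ¬ (x ≡ x′ × y ≡ y′) → ¬ Adj G x y′
      class-unlinked {x} {y} {x′} {y′} (mxy , hy , _) (mx′y′ , hy′ , _) x≡x′ distinct =
        proj₁ (proj₂ (lazy s) x y x′ y′
                 (class-tree mxy) (proj₂ (proj₁ mxy) s)
                 (class-tree mx′y′) (proj₂ (proj₁ mx′y′) s) distinct
                 (level s x ,
                  endpoint-dist (class-tree mxy) ,
                  subst (Dist (Adj G) s x′) (sym x≡x′) (endpoint-dist (class-tree mx′y′)) ,
                  subst (Dist (Adj G) s y) hy (endpoint-dist (T-sym (class-tree mxy))) ,
                  subst (Dist (Adj G) s y′) (trans hy′ (cong suc (sym x≡x′)))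
                        (endpoint-dist (T-sym (class-tree mx′y′)))))

    class-inducedMatching : ∀ r s → IsInducedMatching G (Class r s)
    class-inducedMatching r s = levelled⇒inducedMatching (Class r s) (level s) r G
      (λ u v → nonBranching? u v ×-dec (colour u v ≟ combine r s))
      (class-sym {r} {s}) (T-adj ∘ class-tree {r} {s}) (class-rising {r} {s}) (class-graded {r} {s})
      (class-unlinked {r} {s})

lemma3 : (n : ℕ) (G : Graph n) (P : PairSet n) (π : Scheme n) →
    Bipartite G →
    IsTiebreaking G π →
    (∀ s t → P s t ≡ true → Reachable (Adj G) s t) →
    IsLazy G P π →
    PartitionInto G (3 * n) (NonBranchingEdges P π)
lemma3 n G P π bipartite tiebreaking reachable lazy =
  colour , (λ u v e → colour-sym (proj₂ (proj₁ e))) , λ i →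
    subst (λ i → IsInducedMatching G (λ u v → NonBranchingEdges P π u v × colour u v ≡ i))
          (combine-remQuot {3} n i)
          (class-inducedMatching bipartite lazy (proj₁ (remQuot n i)) (proj₂ (remQuot n i)))
  where open TreeLevels G P π tiebreaking reachable
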